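{- Any streaming certification scheme for $\mathrm{MaxMatching}_{\geq}$ using $c$-bit certificates and $m$ bits of verifier work-memory on $n$-node graphs satisfies $c+m=\Omega(n)$.
   Context: Inputs are an $n$-node graph $G$ on vertex set $[n]$ together with an integer threshold $k$; the threshold $k$ is given first, and then the edges of $G$ arrive as a stream in an arbitrary, possibly adversarial, order. A streaming certification scheme for a decision problem $P$ consists of a prover and a verifier. The prover is a computationally unlimited function which, for each input, produces a certificate in $\{0,1\}^*$ depending only on the input (not on the order of the edges). The verifier is a deterministic streaming algorithm with read-only access to the certificate that processes the edge stream and outputs accept or reject at the end. Completeness: if the input satisfies $P$, there is a certificate such that for every edge order the verifier accepts. Soundness: if the input does not satisfy $P$, then for every certificate and every edge order the verifier rejects. Here $c$ is the certificate length and $m$ the verifier's memory excluding the read-only certificate, both as functions of $n$ in the worst case. $\mathrm{MaxMatching}_{\geq}$ asks whether the maximum matching of $G$ has size at least $k$. -}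

module Defs where

open import Data.Nat using (ℕ; _≤_; _+_; _*_)
open import Data.Bool using (Bool; true; false)
open import Data.Fin as Fin using (Fin)
open import Data.Product using (Σ; _×_; _,_; proj₁; proj₂; ∃; ∃-syntax)
open import Data.List using (List; []; _∷_; length; foldl; concatMap)
open import Data.List.Relation.Unary.All using (All)
open import Data.List.Relation.Unary.Unique.Propositional using (Unique)
open import Data.List.Membership.Propositional using (_∈_)
open import Data.Vec using (Vec)
open import Relation.Binary.PropositionalEquality using (_≡_)
open import Relation.Nullary using (¬_)

-- An edge {i,j} of a simple graph on vertex set [n] = Fin n,
-- encoded canonically as an ordered pair with i < j.
Edge : ℕ → Set
Edge n = Σ (Fin n × Fin n) (λ p → proj₁ p Fin.< proj₂ p)

Graph : ℕ → Set
Graph n = Edge n → Bool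

endpoints : ∀ {n} → List (Edge n) → List (Fin n)
endpoints = concatMap (λ e → proj₁ (proj₁ e) ∷ proj₂ (proj₁ e) ∷ [])

-- M is a matching of G: edges of G, pairwise vertex-disjoint
-- (all endpoints distinct, which also forces the edges to be distinct).
IsMatching : ∀ {n} → Graph n → List (Edge n) → Set
IsMatching G M = All (λ e → G e ≡ true) M × Unique (endpoints M)

MaxMatchingGeq : ∀ {n} → Graph n → ℕ → Set
MaxMatchingGeq G k = ∃[ M ] (IsMatching G M × k ≤ length M)

IsEdgeOrder : ∀ {n} → Graph n → List (Edge n) → Set
IsEdgeOrder G s = Unique s × (∀ e → (e ∈ s → G e ≡ true) × (G e ≡ true → e ∈ s))

Certificate : Set
Certificate = List Bool

-- A deterministic streaming verifier on n-node graphs with m bits of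
-- work memory (states = Vec Bool m) and read-only access to the certificate
-- (every transition may depend on the whole certificate).
record Verifier (n m : ℕ) : Set where
  field
    -- state after reading the threshold k (given first)
    init   : Certificate → ℕ → Vec Bool m
    step   : Certificate → Vec Bool m → Edge n → Vec Bool m
    accept : Certificate → Vec Bool m → Bool

run : ∀ {n m} → Verifier n m → Certificate → ℕ → List (Edge n) → Bool
run V cert k s = Verifier.accept V cert (foldl (Verifier.step V cert) (Verifier.init V cert k) s)

IsSchemeForMaxMatching : ∀ {n m} → Verifier n m → (c : ℕ) → Set
IsSchemeForMaxMatching {n} V c =
  (G : Graph n) (k : ℕ) →
    (MaxMatchingGeq G k →
       ∃[ cert ] (length cert ≤ c ×
         (∀ s → IsEdgeOrder G s → run V cert k s ≡ true)))
    ×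
    (¬ MaxMatchingGeq G k →
       ∀ (cert : Certificate) s → IsEdgeOrder G s → run V cert k s ≡ false)

-- A fooling-set argument. For x, y ∈ {0,1}^N build a graph on 5N vertices in which block a is a
-- subgraph of the path 0—1—2—3—4: the first half of the stream contains the edge {0,1} or {3,4}
-- according to x_a, the second half {2,3} or {1,2} according to y_a. These 2N edges are pairwise
-- disjoint iff x = y (otherwise two of them meet in vertex 1 or 3), so the matching threshold 2N
-- is reached exactly when x = y. If x ≠ y shared the certificate accepted on (y, y) and the
-- verifier reached the same state after the first halves of (x, y) and (y, y), it would accept
-- (x, y). Hence x ↦ (certificate, state after the first half) is injective, so N ≤ 1 + c + m,
-- and N = ⌊n/5⌋ gives n = O(c + m).

module Submission where

open import Defs
open import Data.Nat using (ℕ; zero; suc; _≤_; _<_; _+_; _*_; _^_; _/_; s≤s)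
open import Data.Nat.Properties
  using ( ≤-refl; ≤-reflexive; <-≤-trans; <-irrelevant; <⇒≢; <⇒≱; ≮⇒≥; n<1+n; n≮n
        ; +-monoʳ-<; +-monoˡ-<; +-monoʳ-≤; *-monoˡ-≤; *-monoʳ-≤; *-suc; *-comm; *-distribˡ-+
        ; *-cancelˡ-<; ^-monoʳ-<; <⇒≤; m≤m+n; module ≤-Reasoning )
open import Data.Nat.DivMod using (m≡m%n+[m/n]*n; m%n<n; m/n*n≤m)
open import Data.Bool as Bool using (Bool; true; false)
open import Data.Fin as Fin using (Fin; toℕ; combine; remQuot; inject₁; inject≤; #_)
open import Data.Fin.Properties
  using ( injective⇒≤; combine-injective; combine-remQuot; toℕ-combine; toℕ-inject≤
        ; inject≤-injective; ≤̄⇒inject₁<; 2↔Bool; ¬∀⟶∃¬ )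
open import Data.List using (List; []; _∷_; length; lookup; tabulate; filter; concat; map; foldl; _++_)
open import Data.List.Properties using (length-++; length-tabulate; filter-notAll; map-++; concat-++; foldl-++)
open import Data.List.Relation.Unary.Any as Any using (here; there; index)
open import Data.List.Relation.Unary.Any.Properties using (lookup-index)
open import Data.List.Relation.Unary.All as All using ([]; _∷_)
import Data.List.Relation.Unary.All.Properties as All
open import Data.List.Relation.Unary.AllPairs using (AllPairs; []; _∷_)
import Data.List.Relation.Unary.AllPairs.Properties as AllPairs
open import Data.List.Relation.Unary.Unique.Propositional using (Unique)
import Data.List.Relation.Unary.Unique.Propositional.Properties as Unique
open import Data.List.Relation.Binary.Disjoint.Propositional using (Disjoint)
open import Data.List.Relation.Binary.Subset.Propositional using (_⊆_)
import Data.List.Relation.Binary.Subset.Propositional.Properties as Subset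
open import Data.List.Membership.Propositional using (_∈_)
open import Data.List.Membership.Propositional.Properties
  using (∈-lookup; ∈-++⁺ˡ; ∈-++⁺ʳ; ∈-++⁻; ∈-filter⁺; ∈-concat⁺′; ∈-map⁺; ∈-map⁻; ∈-tabulate⁺; ∈-tabulate⁻)
import Data.List.Membership.DecPropositional as DecMembership
open import Data.Vec as Vec using (Vec; []; _∷_; replicate)
import Data.Vec.Properties as Vec
open import Data.Product using (∃-syntax; _×_; _,_; proj₁; proj₂)
import Data.Product.Properties as Product
open import Data.Sum using (_⊎_; inj₁; inj₂)
open import Data.Empty using (⊥-elim)
open import Function using (_∘_)
open import Function.Bundles using (Inverse)
open import Relation.Binary.Definitions using (DecidableEquality)
open import Relation.Binary.PropositionalEquality
  using (_≡_; _≢_; refl; sym; trans; cong; cong₂; subst; subst₂; module ≡-Reasoning)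
open import Relation.Nullary using (Dec; does; yes; no; ¬_; ¬?)
open import Relation.Nullary.Decidable using (map′)

module _ {A : Set} where

  Unique⇒lookup-injective : ∀ {xs : List A} → Unique xs → ∀ {i j} → lookup xs i ≡ lookup xs j → i ≡ j
  Unique⇒lookup-injective (_  ∷ _) {Fin.zero}  {Fin.zero}  _  = refl
  Unique⇒lookup-injective (x∉ ∷ _) {Fin.zero}  {Fin.suc j} eq = ⊥-elim (All.lookup x∉ (∈-lookup j) eq)
  Unique⇒lookup-injective (x∉ ∷ _) {Fin.suc i} {Fin.zero}  eq = ⊥-elim (All.lookup x∉ (∈-lookup i) (sym eq))
  Unique⇒lookup-injective (_  ∷ u) {Fin.suc i} {Fin.suc j} eq = cong Fin.suc (Unique⇒lookup-injective u eq)

  Unique-⊆⇒length-≤ : ∀ {xs ys : List A} → Unique xs → xs ⊆ ys → length xs ≤ length ys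
  Unique-⊆⇒length-≤ {xs} {ys} u xs⊆ys = injective⇒≤ {f = position} position-injective
    where
    position : Fin (length xs) → Fin (length ys)
    position i = index (xs⊆ys (∈-lookup i))
    position-injective : ∀ {i j} → position i ≡ position j → i ≡ j
    position-injective {i} {j} eq = Unique⇒lookup-injective u (begin
      lookup xs i                  ≡⟨ lookup-index (xs⊆ys (∈-lookup i)) ⟩
      lookup ys (position i)       ≡⟨ cong (lookup ys) eq ⟩
      lookup ys (position j)       ≡⟨ lookup-index (xs⊆ys (∈-lookup j)) ⟨
      lookup xs j                  ∎)
      where open ≡-Reasoning

  Unique-⊆-++⇒length-< : DecidableEquality A → ∀ {xs ys zs : List A} {v} → Unique xs → xs ⊆ ys ++ zs →
                          v ∈ ys → v ∈ zs → length xs < length ys + length zs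
  Unique-⊆-++⇒length-< _≟_ {xs} {ys} {zs} {v} u xs⊆ys++zs v∈ys v∈zs = begin-strict
    length xs               ≤⟨ Unique-⊆⇒length-≤ u xs⊆ys++zs′ ⟩
    length (ys ++ zs′)      ≡⟨ length-++ ys ⟩
    length ys + length zs′  <⟨ +-monoʳ-< (length ys) (filter-notAll ≢v? zs v∈zs′) ⟩
    length ys + length zs   ∎
    where
    open ≤-Reasoning
    ≢v? : ∀ x → Dec (x ≢ v)
    ≢v? x = ¬? (x ≟ v)
    zs′ : List A
    zs′ = filter ≢v? zs
    v∈zs′ : Any.Any (λ x → ¬ (x ≢ v)) zs
    v∈zs′ = Any.map (λ { refl v≢v → v≢v refl }) v∈zs
    xs⊆ys++zs′ : xs ⊆ ys ++ zs′
    xs⊆ys++zs′ {x} x∈xs with ∈-++⁻ ys (xs⊆ys++zs x∈xs) | x ≟ v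
    ... | inj₁ x∈ys | _        = ∈-++⁺ˡ x∈ys
    ... | inj₂ _    | yes refl = ∈-++⁺ˡ v∈ys
    ... | inj₂ x∈zs | no x≢v   = ∈-++⁺ʳ ys (∈-filter⁺ ≢v? x∈zs x≢v)

open Inverse 2↔Bool using ()
  renaming ( to to Fin2→Bool; from to Bool→Fin2
           ; strictlyInverseˡ to Fin2→Bool∘Bool→Fin2; strictlyInverseʳ to Bool→Fin2∘Fin2→Bool )

Bool→Fin2-injective : ∀ {b b′} → Bool→Fin2 b ≡ Bool→Fin2 b′ → b ≡ b′
Bool→Fin2-injective {b} {b′} eq =
  trans (sym (Fin2→Bool∘Bool→Fin2 b)) (trans (cong Fin2→Bool eq) (Fin2→Bool∘Bool→Fin2 b′))

bits→Fin : ∀ {N} → Vec Bool N → Fin (2 ^ N)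
bits→Fin []      = Fin.zero
bits→Fin (b ∷ v) = combine (Bool→Fin2 b) (bits→Fin v)

Fin→bits : ∀ {N} → Fin (2 ^ N) → Vec Bool N
Fin→bits {zero}  _ = []
Fin→bits {suc N} i = Fin2→Bool (proj₁ (remQuot {2} (2 ^ N) i)) ∷ Fin→bits (proj₂ (remQuot {2} (2 ^ N) i))

bits→Fin-injective : ∀ {N} {u v : Vec Bool N} → bits→Fin u ≡ bits→Fin v → u ≡ v
bits→Fin-injective {u = []}    {[]}    _  = refl
bits→Fin-injective {u = b ∷ u} {c ∷ v} eq
  with combine-injective (Bool→Fin2 b) (bits→Fin u) (Bool→Fin2 c) (bits→Fin v) eq
... | b≡c , u≡v = cong₂ _∷_ (Bool→Fin2-injective b≡c) (bits→Fin-injective u≡v)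

bits→Fin∘Fin→bits : ∀ {N} (i : Fin (2 ^ N)) → bits→Fin (Fin→bits {N} i) ≡ i
bits→Fin∘Fin→bits {zero}  Fin.zero = refl
bits→Fin∘Fin→bits {suc N} i = trans
  (cong₂ combine (Bool→Fin2∘Fin2→Bool (proj₁ (remQuot {2} (2 ^ N) i)))
                 (bits→Fin∘Fin→bits {N} (proj₂ (remQuot {2} (2 ^ N) i))))
  (combine-remQuot {2} (2 ^ N) i)

bitVector-injection⇒≤ : ∀ {N M} (f : Vec Bool N → Vec Bool M) → (∀ {u v} → f u ≡ f v → u ≡ v) → N ≤ M
bitVector-injection⇒≤ {N} {M} f f-injective =
  ≮⇒≥ (λ M<N → <⇒≱ (^-monoʳ-< 2 (n<1+n 1) M<N) (injective⇒≤ {f = g} g-injective))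
  where
  g : Fin (2 ^ N) → Fin (2 ^ M)
  g = bits→Fin ∘ f ∘ Fin→bits
  g-injective : ∀ {i j} → g i ≡ g j → i ≡ j
  g-injective {i} {j} eq = begin
    i                         ≡⟨ bits→Fin∘Fin→bits {N} i ⟨
    bits→Fin (Fin→bits {N} i) ≡⟨ cong bits→Fin (f-injective (bits→Fin-injective {M} eq)) ⟩
    bits→Fin (Fin→bits {N} j) ≡⟨ bits→Fin∘Fin→bits {N} j ⟩
    j                         ∎
    where open ≡-Reasoning

pad : ∀ c (l : List Bool) → length l ≤ c → Vec Bool (suc c)
pad c       []      _       = true ∷ replicate c false
pad (suc c) (b ∷ l) (s≤s p) = b ∷ pad c l p

pad≢replicate : ∀ c (l : List Bool) (p : length l ≤ c) → pad c l p ≢ replicate (suc c) false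
pad≢replicate c       []      _       ()
pad≢replicate (suc c) (b ∷ l) (s≤s p) eq = pad≢replicate c l p (Vec.∷-injectiveʳ eq)

pad-injective : ∀ c {l l′ : List Bool} (p : length l ≤ c) (p′ : length l′ ≤ c) →
                pad c l p ≡ pad c l′ p′ → l ≡ l′
pad-injective c       {[]}    {[]}     _       _        _  = refl
pad-injective (suc c) {[]}    {_ ∷ l′} _       (s≤s p′) eq = ⊥-elim (pad≢replicate c l′ p′ (sym (Vec.∷-injectiveʳ eq)))
pad-injective (suc c) {_ ∷ l} {[]}     (s≤s p) _        eq = ⊥-elim (pad≢replicate c l p (Vec.∷-injectiveʳ eq))
pad-injective (suc c) {b ∷ l} {_ ∷ l′} (s≤s p) (s≤s p′) eq with Vec.∷-injective eq
... | refl , tl = cong (b ∷_) (pad-injective c p p′ tl)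

≢⇒∃lookup-≢ : ∀ {A : Set} → DecidableEquality A → ∀ {N} {x y : Vec A N} →
              x ≢ y → ∃[ a ] Vec.lookup x a ≢ Vec.lookup y a
≢⇒∃lookup-≢ _≟_ {N} {x} {y} x≢y = ¬∀⟶∃¬ N _ (λ a → Vec.lookup x a ≟ Vec.lookup y a) (x≢y ∘ lookup-ext)
  where
  lookup-ext : (∀ a → Vec.lookup x a ≡ Vec.lookup y a) → x ≡ y
  lookup-ext x≗y = begin
    x                          ≡⟨ Vec.tabulate∘lookup x ⟨
    Vec.tabulate (Vec.lookup x) ≡⟨ Vec.tabulate-cong x≗y ⟩
    Vec.tabulate (Vec.lookup y) ≡⟨ Vec.tabulate∘lookup y ⟩
    y                          ∎
    where open ≡-Reasoning

module _ {n : ℕ} where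

  ends : Edge n → List (Fin n)
  ends e = proj₁ (proj₁ e) ∷ proj₂ (proj₁ e) ∷ []

  VertexDisjoint : Edge n → Edge n → Set
  VertexDisjoint e e′ = Disjoint (ends e) (ends e′)

  Edge-≡ : {e e′ : Edge n} → proj₁ e ≡ proj₁ e′ → e ≡ e′
  Edge-≡ {_ , u<v} {_ , u<v′} refl = cong (_ ,_) (<-irrelevant u<v u<v′)

  _≟ₑ_ : DecidableEquality (Edge n)
  e ≟ₑ e′ = map′ Edge-≡ (cong proj₁) (Product.≡-dec Fin._≟_ Fin._≟_ (proj₁ e) (proj₁ e′))

  open DecMembership _≟ₑ_ using (_∈?_)

  graphOf : List (Edge n) → Graph n
  graphOf s e = does (e ∈? s)

  ∈⇒graphOf : ∀ {s e} → e ∈ s → graphOf s e ≡ true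
  ∈⇒graphOf {s} {e} e∈s with e ∈? s
  ... | yes _   = refl
  ... | no e∉s = ⊥-elim (e∉s e∈s)

  graphOf⇒∈ : ∀ {s e} → graphOf s e ≡ true → e ∈ s
  graphOf⇒∈ {s} {e} _ with e ∈? s
  graphOf⇒∈ _ | yes e∈s = e∈s

  Unique⇒IsEdgeOrder-graphOf : ∀ {s} → Unique s → IsEdgeOrder (graphOf s) s
  Unique⇒IsEdgeOrder-graphOf u = u , λ _ → ∈⇒graphOf , graphOf⇒∈

  ends-Unique : ∀ e → Unique (ends e)
  ends-Unique (_ , u<v) = ((λ u≡v → <⇒≢ u<v (cong toℕ u≡v)) ∷ []) ∷ [] ∷ []

  endpoints-++ : (M M′ : List (Edge n)) → endpoints (M ++ M′) ≡ endpoints M ++ endpoints M′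
  endpoints-++ M M′ = trans (cong concat (map-++ ends M M′)) (sym (concat-++ (map ends M) (map ends M′)))

  length-endpoints : (M : List (Edge n)) → length (endpoints M) ≡ 2 * length M
  length-endpoints []      = refl
  length-endpoints (_ ∷ M) = trans (cong (suc ∘ suc) (length-endpoints M)) (sym (*-suc 2 (length M)))

  ends⊆endpoints : ∀ {e M} → e ∈ M → ends e ⊆ endpoints M
  ends⊆endpoints e∈M v∈e = ∈-concat⁺′ v∈e (∈-map⁺ ends e∈M)

  pairwiseVertexDisjoint⇒Unique-endpoints : ∀ {M} → AllPairs VertexDisjoint M → Unique (endpoints M)
  pairwiseVertexDisjoint⇒Unique-endpoints {M} disjoint =
    Unique.concat⁺ (All.map⁺ (All.universal ends-Unique M)) (AllPairs.map⁺ disjoint)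

  matching-length-< : ∀ {G M A B v} → IsMatching G M → (∀ {e} → G e ≡ true → e ∈ A ++ B) →
                      v ∈ endpoints A → v ∈ endpoints B → length M < length A + length B
  matching-length-< {G} {M} {A} {B} (M⊆G , distinct) G⊆A++B v∈A v∈B = *-cancelˡ-< 2 _ _ (begin-strict
    2 * length M                                   ≡⟨ length-endpoints M ⟨
    length (endpoints M)                           <⟨ Unique-⊆-++⇒length-< Fin._≟_ distinct endpoints-M⊆ v∈A v∈B ⟩
    length (endpoints A) + length (endpoints B)    ≡⟨ cong₂ _+_ (length-endpoints A) (length-endpoints B) ⟩
    2 * length A + 2 * length B                    ≡⟨ *-distribˡ-+ 2 (length A) (length B) ⟨
    2 * (length A + length B)                      ∎)
    where
    open ≤-Reasoning
    endpoints-M⊆ : endpoints M ⊆ endpoints A ++ endpoints B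
    endpoints-M⊆ = subst (endpoints M ⊆_) (endpoints-++ A B)
      (Subset.concatMap⁺ ends (λ e∈M → G⊆A++B (All.lookup M⊆G e∈M)))

module HardInstances (n N : ℕ) (N*5≤n : N * 5 ≤ n) where

  vertex : Fin N → Fin 5 → Fin n
  vertex a o = inject≤ (combine a o) N*5≤n

  toℕ-vertex : ∀ a o → toℕ (vertex a o) ≡ 5 * toℕ a + toℕ o
  toℕ-vertex a o = trans (toℕ-inject≤ (combine a o) N*5≤n) (toℕ-combine a o)

  vertex-injective : ∀ {a a′ o o′} → vertex a o ≡ vertex a′ o′ → a ≡ a′ × o ≡ o′
  vertex-injective {a} {a′} {o} {o′} eq = combine-injective a o a′ o′ (inject≤-injective N*5≤n N*5≤n _ _ eq)

  vertex-monoʳ-< : ∀ a {o o′} → o Fin.< o′ → vertex a o Fin.< vertex a o′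
  vertex-monoʳ-< a {o} {o′} o<o′ =
    subst₂ _<_ (sym (toℕ-vertex a o)) (sym (toℕ-vertex a o′)) (+-monoʳ-< (5 * toℕ a) o<o′)

  blockEdge : Fin N → Edge 5 → Edge n
  blockEdge a e = (vertex a (proj₁ (proj₁ e)) , vertex a (proj₂ (proj₁ e))) , vertex-monoʳ-< a (proj₂ e)

  blockEdge-injective : ∀ {a a′ e e′} → blockEdge a e ≡ blockEdge a′ e′ → a ≡ a′ × e ≡ e′
  blockEdge-injective eq
    with vertex-injective (cong (proj₁ ∘ proj₁) eq) | vertex-injective (cong (proj₂ ∘ proj₁) eq)
  ... | refl , u≡u′ | _ , v≡v′ = refl , Edge-≡ (cong₂ _,_ u≡u′ v≡v′)

  blockEdge-vertexDisjoint : ∀ {a a′ e e′} → a ≢ a′ ⊎ VertexDisjoint e e′ →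
                             VertexDisjoint (blockEdge a e) (blockEdge a′ e′)
  blockEdge-vertexDisjoint {a} {a′} separated (v∈ , v∈′)
    with ∈-map⁻ (vertex a) v∈ | ∈-map⁻ (vertex a′) v∈′
  ... | o , o∈e , refl | o′ , o′∈e′ , v≡v′ with vertex-injective v≡v′ | separated
  ...   | a≡a′ , _    | inj₁ a≢a′   = a≢a′ a≡a′
  ...   | _    , refl | inj₂ e#e′   = e#e′ (o∈e , o′∈e′)

  pathEdge : Fin 4 → Edge 5
  pathEdge o = (inject₁ o , Fin.suc o) , ≤̄⇒inject₁< ≤-refl

  aliceEdge bobEdge : Bool → Edge 5
  aliceEdge false = pathEdge (# 0)
  aliceEdge true  = pathEdge (# 3)
  bobEdge   false = pathEdge (# 2)
  bobEdge   true  = pathEdge (# 1)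

  aliceEdge≢bobEdge : ∀ b b′ → aliceEdge b ≢ bobEdge b′
  aliceEdge≢bobEdge false false ()
  aliceEdge≢bobEdge false true  ()
  aliceEdge≢bobEdge true  false ()
  aliceEdge≢bobEdge true  true  ()

  aliceEdge-bobEdge-vertexDisjoint : ∀ b → VertexDisjoint (aliceEdge b) (bobEdge b)
  aliceEdge-bobEdge-vertexDisjoint false (here refl , there (there ()))
  aliceEdge-bobEdge-vertexDisjoint false (there (here refl) , there (there ()))
  aliceEdge-bobEdge-vertexDisjoint true  (here refl , there (there ()))
  aliceEdge-bobEdge-vertexDisjoint true  (there (here refl) , there (there ()))

  aliceEdge-bobEdge-meet : ∀ {b b′} → b ≢ b′ → ∃[ o ] (o ∈ ends (aliceEdge b) × o ∈ ends (bobEdge b′))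
  aliceEdge-bobEdge-meet {false} {false} b≢b′ = ⊥-elim (b≢b′ refl)
  aliceEdge-bobEdge-meet {false} {true}  _    = _ , there (here refl) , here refl
  aliceEdge-bobEdge-meet {true}  {false} _    = _ , here refl , there (here refl)
  aliceEdge-bobEdge-meet {true}  {true}  b≢b′ = ⊥-elim (b≢b′ refl)

  blocks : (Fin N → Edge 5) → List (Edge n)
  blocks g = tabulate (λ a → blockEdge a (g a))

  blocks-Unique : ∀ g → Unique (blocks g)
  blocks-Unique g = AllPairs.tabulate⁺ (λ a≢a′ eq → a≢a′ (proj₁ (blockEdge-injective eq)))

  blocks-pairwiseVertexDisjoint : ∀ g → AllPairs VertexDisjoint (blocks g)
  blocks-pairwiseVertexDisjoint g =
    AllPairs.tabulate⁺ (λ {a} {a′} a≢a′ → blockEdge-vertexDisjoint {e = g a} {g a′} (inj₁ a≢a′))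

  length-blocks : ∀ g → length (blocks g) ≡ N
  length-blocks g = length-tabulate (λ a → blockEdge a (g a))

  aliceEdges bobEdges : Vec Bool N → List (Edge n)
  aliceEdges x = blocks (aliceEdge ∘ Vec.lookup x)
  bobEdges   y = blocks (bobEdge ∘ Vec.lookup y)

  stream : Vec Bool N → Vec Bool N → List (Edge n)
  stream x y = aliceEdges x ++ bobEdges y

  length-halves : ∀ x y → length (aliceEdges x) + length (bobEdges y) ≡ N + N
  length-halves x y = cong₂ _+_ (length-blocks _) (length-blocks _)

  length-stream : ∀ x y → length (stream x y) ≡ N + N
  length-stream x y = trans (length-++ (aliceEdges x)) (length-halves x y)

  stream-Unique : ∀ x y → Unique (stream x y)
  stream-Unique x y = Unique.++⁺ (blocks-Unique _) (blocks-Unique _) separated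
    where
    separated : Disjoint (aliceEdges x) (bobEdges y)
    separated (e∈A , e∈B) with ∈-tabulate⁻ e∈A | ∈-tabulate⁻ e∈B
    ... | a , refl | a′ , eq = aliceEdge≢bobEdge (Vec.lookup x a) (Vec.lookup y a′) (proj₂ (blockEdge-injective eq))

  stream-pairwiseVertexDisjoint : ∀ x → AllPairs VertexDisjoint (stream x x)
  stream-pairwiseVertexDisjoint x =
    AllPairs.++⁺ (blocks-pairwiseVertexDisjoint _) (blocks-pairwiseVertexDisjoint _)
      (All.tabulate⁺ λ a → All.tabulate⁺ λ a′ →
         blockEdge-vertexDisjoint {e = aliceEdge (Vec.lookup x a)} {bobEdge (Vec.lookup x a′)} (separated a a′))
    where
    separated : ∀ a a′ → a ≢ a′ ⊎ VertexDisjoint (aliceEdge (Vec.lookup x a)) (bobEdge (Vec.lookup x a′))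
    separated a a′ with a Fin.≟ a′
    ... | yes refl = inj₂ (aliceEdge-bobEdge-vertexDisjoint (Vec.lookup x a))
    ... | no a≢a′  = inj₁ a≢a′

  stream-meet : ∀ {x y} → x ≢ y → ∃[ v ] (v ∈ endpoints (aliceEdges x) × v ∈ endpoints (bobEdges y))
  stream-meet x≢y with ≢⇒∃lookup-≢ Bool._≟_ x≢y
  ... | a , xₐ≢yₐ with aliceEdge-bobEdge-meet xₐ≢yₐ
  ...   | o , o∈A , o∈B =
    vertex a o , ends⊆endpoints (∈-tabulate⁺ a) (∈-map⁺ (vertex a) o∈A)
               , ends⊆endpoints (∈-tabulate⁺ a) (∈-map⁺ (vertex a) o∈B)

  stream-matched : ∀ x → MaxMatchingGeq (graphOf (stream x x)) (N + N)
  stream-matched x =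
    stream x x , (All.tabulate ∈⇒graphOf , pairwiseVertexDisjoint⇒Unique-endpoints (stream-pairwiseVertexDisjoint x)) ,
    ≤-reflexive (sym (length-stream x x))

  stream-unmatched : ∀ {x y} → x ≢ y → ¬ MaxMatchingGeq (graphOf (stream x y)) (N + N)
  stream-unmatched {x} {y} x≢y (M , M-matching , N+N≤M) with stream-meet x≢y
  ... | v , v∈A , v∈B = <⇒≱ (subst (length M <_) (length-halves x y) M<|A|+|B|) N+N≤M
    where
    M<|A|+|B| : length M < length (aliceEdges x) + length (bobEdges y)
    M<|A|+|B| = matching-length-< {A = aliceEdges x} M-matching graphOf⇒∈ v∈A v∈B

module _ {n m : ℕ} (V : Verifier n m) where
  open Verifier V

  stateAfter : Certificate → ℕ → List (Edge n) → Vec Bool m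
  stateAfter cert k = foldl (step cert) (init cert k)

  run-++-cut : ∀ cert k A A′ B → stateAfter cert k A ≡ stateAfter cert k A′ →
               run V cert k (A ++ B) ≡ run V cert k (A′ ++ B)
  run-++-cut cert k A A′ B same = begin
    run V cert k (A ++ B)                                  ≡⟨ cong (accept cert) (foldl-++ (step cert) (init cert k) A B) ⟩
    accept cert (foldl (step cert) (stateAfter cert k A) B)  ≡⟨ cong (λ s → accept cert (foldl (step cert) s B)) same ⟩
    accept cert (foldl (step cert) (stateAfter cert k A′) B) ≡⟨ cong (accept cert) (foldl-++ (step cert) (init cert k) A′ B) ⟨
    run V cert k (A′ ++ B)                                 ∎
    where open ≡-Reasoning

module FoolingSet {n m c N : ℕ} (V : Verifier n m) (k : ℕ) (A B : Vec Bool N → List (Edge n))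
                  (cert : Vec Bool N → Certificate) (cert-short : ∀ x → length (cert x) ≤ c)
                  (accepted : ∀ x → run V (cert x) k (A x ++ B x) ≡ true)
                  (rejected : ∀ {x y} → x ≢ y → ∀ cert′ → run V cert′ k (A x ++ B y) ≡ false) where

  summary : Vec Bool N → Vec Bool (suc (c + m))
  summary x = pad c (cert x) (cert-short x) Vec.++ stateAfter V (cert x) k (A x)

  summary-injective : ∀ {x y} → summary x ≡ summary y → x ≡ y
  summary-injective {x} {y} eq with Vec.≡-dec Bool._≟_ x y
  ... | yes x≡y = x≡y
  ... | no x≢y  = ⊥-elim (true≢false (begin
    true                            ≡⟨ accepted y ⟨
    run V (cert y) k (A y ++ B y)   ≡⟨ run-++-cut V (cert y) k (A x) (A y) (B y) same-state ⟨
    run V (cert y) k (A x ++ B y)   ≡⟨ rejected x≢y (cert y) ⟩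
    false                           ∎))
    where
    open ≡-Reasoning
    same-cert : cert x ≡ cert y
    same-cert = pad-injective c (cert-short x) (cert-short y) (Vec.++-injectiveˡ _ _ eq)
    same-state : stateAfter V (cert y) k (A x) ≡ stateAfter V (cert y) k (A y)
    same-state = subst (λ w → stateAfter V w k (A x) ≡ stateAfter V (cert y) k (A y)) same-cert
                       (Vec.++-injectiveʳ (pad c (cert x) (cert-short x)) (pad c (cert y) (cert-short y)) eq)
    true≢false : true ≢ false
    true≢false ()

  N≤1+c+m : N ≤ suc (c + m)
  N≤1+c+m = bitVector-injection⇒≤ summary summary-injective

N*5≤n⇒N≤1+c+m : ∀ {n m c N} → N * 5 ≤ n → (V : Verifier n m) → IsSchemeForMaxMatching V c → N ≤ suc (c + m)
N*5≤n⇒N≤1+c+m {n} {c = c} {N} N*5≤n V scheme =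
  FoolingSet.N≤1+c+m V k aliceEdges bobEdges (proj₁ ∘ honest) (proj₁ ∘ proj₂ ∘ honest) accepted rejected
  where
  open HardInstances n N N*5≤n
  k : ℕ
  k = N + N
  honest : ∀ x → ∃[ cert ] (length cert ≤ c ×
                            (∀ s → IsEdgeOrder (graphOf (stream x x)) s → run V cert k s ≡ true))
  honest x = proj₁ (scheme (graphOf (stream x x)) k) (stream-matched x)
  accepted : ∀ x → run V (proj₁ (honest x)) k (stream x x) ≡ true
  accepted x = proj₂ (proj₂ (honest x)) (stream x x) (Unique⇒IsEdgeOrder-graphOf (stream-Unique x x))
  rejected : ∀ {x y} → x ≢ y → ∀ cert → run V cert k (stream x y) ≡ false
  rejected {x} {y} x≢y cert =
    proj₂ (scheme (graphOf (stream x y)) k) (stream-unmatched x≢y) cert (stream x y)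
      (Unique⇒IsEdgeOrder-graphOf (stream-Unique x y))

n<[1+n/5]*5 : ∀ n → n < suc (n / 5) * 5
n<[1+n/5]*5 n = subst (_< suc (n / 5) * 5) (sym (m≡m%n+[m/n]*n n 5)) (+-monoˡ-< ((n / 5) * 5) (m%n<n n 5))

linear-bound : ∀ n s → 10 ≤ n → n < (2 + s) * 5 → n ≤ 15 * s
linear-bound n zero    10≤n n<10 = ⊥-elim (n≮n _ (<-≤-trans n<10 10≤n))
linear-bound n (suc t) _    n<[3+t]*5 = begin
  n             ≤⟨ <⇒≤ n<[3+t]*5 ⟩
  15 + t * 5    ≤⟨ +-monoʳ-≤ 15 (*-monoʳ-≤ t (m≤m+n 5 10)) ⟩
  15 + t * 15   ≡⟨ *-comm (suc t) 15 ⟩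
  15 * suc t    ∎
  where open ≤-Reasoning

theorem7 : (c m : ℕ → ℕ) (V : (n : ℕ) → Verifier n (m n)) →
           ((n : ℕ) → IsSchemeForMaxMatching (V n) (c n)) →
           ∃[ a ] ∃[ n₀ ] ((n : ℕ) → n₀ ≤ n → n ≤ a * (c n + m n))
theorem7 c m V scheme = 15 , 10 , λ n 10≤n → linear-bound n (c n + m n) 10≤n (begin-strict
  n                         <⟨ n<[1+n/5]*5 n ⟩
  suc (n / 5) * 5           ≤⟨ *-monoˡ-≤ 5 (s≤s (N*5≤n⇒N≤1+c+m {N = n / 5} (m/n*n≤m n 5) (V n) (scheme n))) ⟩
  (2 + (c n + m n)) * 5     ∎)
  where open ≤-Reasoning
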